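{- Let $G$ be a finite simple undirected connected graph, $F$ a diagonal matching rule for $G$, and $M$ the prefix matching generated by $F$. If $M$ is a Morse matching (i.e. $\Gamma^M$ has no directed cycle), then $G$ is diagonal, i.e. $\mathrm{MH}_{k,l}(G)\ne 0$ only if $k=l$.
   Context: $d$ is the shortest-path metric of $G$, $\ell(x_0,\ldots,x_k)=\sum_{i=0}^{k-1}d(x_i,x_{i+1})$. A "sequence" means a tuple $(x_0,\ldots,x_k)\in V(G)^{k+1}$ ($k\ge 0$) with $x_i\ne x_{i+1}$ for all $i$. The magnitude chain group $\mathrm{MC}_{k,l}(G)$ is free abelian on sequences of length $k+1$ with $\ell=l$, with differential $\partial=\sum_{1\le i\le k-1}(-1)^i\partial_i$, where $\partial_i$ deletes $x_i$ if this preserves $\ell$ and is $0$ otherwise; $\mathrm{MH}_{k,l}(G)=H_k(\mathrm{MC}_{*,l}(G))$. Let $\Gamma$ be the directed graph whose vertices are all sequences and with an edge $a\to b$ whenever $a=(x_0,\ldots,x_k)$ and $b=(x_0,\ldots,\hat x_i,\ldots,x_k)$ for some $1\le i\le k-1$ with $\ell(b)=\ell(a)$. A matching is a set of edges of $\Gamma$, no two sharing an endpoint; $\Gamma^M$ denotes $\Gamma$ with the edges of $M$ reversed. Relative to a matching, the matching state of a sequence $(x_0,\ldots,x_k)$ is: unmatched; insert$(i,v)$ if it is matched to $(x_0,\ldots,x_i,v,x_{i+1},\ldots,x_k)$; or delete$(i)$ if it is matched to $(x_0,\ldots,\hat x_i,\ldots,x_k)$. A prefix matching is a matching such that: if $(x_0,\ldots,x_k)$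 has state insert$(i,v)$ (resp. delete$(i)$), then every sequence of the form $(x_0,\ldots,x_{i+1},y_{i+2},\ldots,y_{k'})$ has state insert$(i,v)$ (resp. delete$(i)$). A matching rule is a function $F$ from finite tuples of vertices to the symbols $\{\epsilon\}\cup\{\iota(v):v\in V(G)\}\cup\{\delta\}$. A prefix matching $M$ is generated by $F$ if for every sequence $(x_0,\ldots,x_k)$ ($k\ge1$) whose prefix $(x_0,\ldots,x_{k-1})$ is unmatched, its state is insert$(k-1,v)$ iff $F(x_0,\ldots,x_k)=\iota(v)$, and delete$(k-1)$ iff $F(x_0,\ldots,x_k)=\delta$. $F$ is valid if: (1) whenever $F(x_0,\ldots,x_k)=\iota(v)$, we have $d(x_{k-1},v)+d(v,x_k)=d(x_{k-1},x_k)$, $F(x_0,\ldots,x_{k-1},v)=\epsilon$ and $F(x_0,\ldots,x_{k-1},v,x_k)=\delta$; (2) whenever $F(x_0,\ldots,x_k)=\delta$, we have $d(x_{k-2},x_{k-1})+d(x_{k-1},x_k)=d(x_{k-2},x_k)$ and $F(x_0,\ldots,x_{k-2},x_k)=\iota(x_{k-1})$. A valid $F$ is diagonal if $F(x_0,\ldots,x_k)\ne\epsilon$ for every sequence $(x_0,\ldots,x_k)$ with unmatched prefix $(x_0,\ldots,x_{k-1})$ and $d(x_{k-1},x_k)\ge 2$. -}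

module Defs where

open import Data.Nat using (ℕ; zero; suc; _+_; _≤_; _<_; _∸_)
import Data.Nat as ℕ
open import Data.Bool using (Bool; true; false; _∧_; _∨_; if_then_else_)
open import Data.Fin using (Fin)
import Data.Fin as Fin
open import Data.List using (List; []; _∷_; _++_; take; drop; length; map; concatMap; allFin; upTo; foldr)
open import Data.Bool.ListAction using (any)
import Data.List.Properties as LP
open import Data.Integer using (ℤ; -_) renaming (_+_ to _+ℤ_; _*_ to _*ℤ_; 0ℤ to zeroℤ; 1ℤ to oneℤ)
open import Data.Product using (_×_; ∃-syntax)
open import Data.Sum using (_⊎_)
open import Data.Unit using (⊤)
open import Relation.Nullary using (¬_; does)
open import Relation.Binary.PropositionalEquality using (_≡_; _≢_)
open import Relation.Binary.Construct.Closure.Transitive using (TransClosure)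
open import Function.Bundles using (_⇔_)

record Graph : Set where
  field
    n          : ℕ
    adj        : Fin n → Fin n → Bool
    adj-sym    : ∀ x y → adj x y ≡ adj y x
    adj-irrefl : ∀ x → adj x x ≡ false

data Sym (V : Set) : Set where
  ε : Sym V
  ι : V → Sym V
  δ : Sym V

module _ (G : Graph) where
  open Graph G

  Vtx : Set
  Vtx = Fin n

  reach : ℕ → Vtx → Vtx → Bool
  reach zero    x y = does (x Fin.≟ y)
  reach (suc m) x y = reach m x y ∨ any (λ z → reach m x z ∧ adj z y) (allFin n)

  Connected : Set
  Connected = ∀ x y → ∃[ m ] reach m x y ≡ true

  dsearch : Vtx → Vtx → ℕ → ℕ → ℕ
  dsearch x y zero    m = m
  dsearch x y (suc f) m = if reach m x y then m else dsearch x y f (suc m)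

  -- shortest-path metric d (for connected G, all distances are < n)
  d : Vtx → Vtx → ℕ
  d x y = dsearch x y n 0

  ℓ : List Vtx → ℕ
  ℓ (a ∷ b ∷ xs) = d a b + ℓ (b ∷ xs)
  ℓ _            = 0

  AdjDistinct : List Vtx → Set
  AdjDistinct (a ∷ b ∷ xs) = a ≢ b × AdjDistinct (b ∷ xs)
  AdjDistinct _            = ⊤

  IsSeq : List Vtx → Set
  IsSeq xs = 1 ≤ length xs × AdjDistinct xs

  del : ℕ → List Vtx → List Vtx
  del i xs = take i xs ++ drop (suc i) xs

  ins : ℕ → Vtx → List Vtx → List Vtx
  ins i v xs = take (suc i) xs ++ v ∷ drop (suc i) xs

  ΓEdge : List Vtx → List Vtx → Set
  ΓEdge a b = IsSeq a × IsSeq b ×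
              ∃[ i ] (1 ≤ i × suc i < length a × b ≡ del i a × ℓ b ≡ ℓ a)

  EdgeSet : Set₁
  EdgeSet = List Vtx → List Vtx → Set

  MatchedWith : EdgeSet → List Vtx → List Vtx → Set
  MatchedWith M x y = M x y ⊎ M y x

  IsMatching : EdgeSet → Set
  IsMatching M = (∀ a b → M a b → ΓEdge a b)
               × (∀ x y z → MatchedWith M x y → MatchedWith M x z → y ≡ z)

  Unmatched : EdgeSet → List Vtx → Set
  Unmatched M x = ∀ y → ¬ MatchedWith M x y

  StateIns : EdgeSet → List Vtx → ℕ → Vtx → Set
  StateIns M x i v = MatchedWith M x (ins i v x)

  StateDel : EdgeSet → List Vtx → ℕ → Set
  StateDel M x i = MatchedWith M x (del i x)

  IsPrefixMatching : EdgeSet → Set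
  IsPrefixMatching M = IsMatching M
    × (∀ x i v → IsSeq x → StateIns M x i v →
         ∀ y → IsSeq y → take (suc (suc i)) y ≡ take (suc (suc i)) x → StateIns M y i v)
    × (∀ x i → IsSeq x → StateDel M x i →
         ∀ y → IsSeq y → take (suc (suc i)) y ≡ take (suc (suc i)) x → StateDel M y i)

  MatchingRule : Set
  MatchingRule = List Vtx → Sym Vtx

  -- M is generated by F.  A sequence (x_0,...,x_k), k ≥ 1, is written p ++ [a , b]
  -- (so x_{k-1} = a, x_k = b, k-1 = length p).
  GeneratedBy : MatchingRule → EdgeSet → Set
  GeneratedBy F M = ∀ p a b → IsSeq (p ++ a ∷ b ∷ []) → Unmatched M (p ++ a ∷ []) →
      (∀ v → StateIns M (p ++ a ∷ b ∷ []) (length p) v ⇔ (F (p ++ a ∷ b ∷ []) ≡ ι v))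
    × (StateDel M (p ++ a ∷ b ∷ []) (length p) ⇔ (F (p ++ a ∷ b ∷ []) ≡ δ))

  Valid : MatchingRule → Set
  Valid F =
      (∀ p a b v → F (p ++ a ∷ b ∷ []) ≡ ι v →
          (d a v + d v b ≡ d a b) × F (p ++ a ∷ v ∷ []) ≡ ε × F (p ++ a ∷ v ∷ b ∷ []) ≡ δ)
    × (∀ p a b c → F (p ++ a ∷ b ∷ c ∷ []) ≡ δ →
          (d a b + d b c ≡ d a c) × F (p ++ a ∷ c ∷ []) ≡ ι b)

  -- diagonal matching rule (unmatched-ness relative to the generated matching M)
  DiagonalRule : MatchingRule → EdgeSet → Set
  DiagonalRule F M = Valid F ×
    (∀ p a b → IsSeq (p ++ a ∷ b ∷ []) → Unmatched M (p ++ a ∷ []) → 2 ≤ d a b →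
       F (p ++ a ∷ b ∷ []) ≢ ε)

  EdgeΓM : EdgeSet → List Vtx → List Vtx → Set
  EdgeΓM M a b = (ΓEdge a b × ¬ M a b) ⊎ M b a

  IsMorse : EdgeSet → Set
  IsMorse M = ∀ a → ¬ TransClosure (EdgeΓM M) a a

  -- A chain in MC_{k,l}(G) is a function
  -- c : List Vtx → ℤ vanishing outside the sequences of length k+1 with ℓ = l
  -- (these are finitely many, so this is the free abelian group on them).

  InMC : ℕ → ℕ → List Vtx → Set
  InMC k l x = IsSeq x × length x ≡ suc k × ℓ x ≡ l

  Chain : ℕ → ℕ → (List Vtx → ℤ) → Set
  Chain k l c = ∀ x → ¬ InMC k l x → c x ≡ zeroℤ

  tuples : ℕ → List (List Vtx)
  tuples zero    = [] ∷ []
  tuples (suc m) = concatMap (λ v → map (v ∷_) (tuples m)) (allFin n)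

  sumℤ : List ℤ → ℤ
  sumℤ = foldr _+ℤ_ zeroℤ

  sign : ℕ → ℤ
  sign zero    = oneℤ
  sign (suc i) = - sign i

  coeff : List Vtx → List Vtx → ℤ
  coeff x y = sumℤ (map (λ i → if does (LP.≡-dec Fin._≟_ (del i x) y) ∧ does (ℓ (del i x) ℕ.≟ ℓ x)
                                then sign i else zeroℤ)
                        (map suc (upTo (length x ∸ 2))))

  bd : ℕ → (List Vtx → ℤ) → List Vtx → ℤ
  bd m c y = sumℤ (map (λ x → c x *ℤ coeff x y) (tuples m))

  MHVanishes : ℕ → ℕ → Set
  MHVanishes k l = ∀ c → Chain k l c → (∀ y → bd (suc k) c y ≡ zeroℤ) →
    ∃[ e ] (Chain (suc k) l e × (∀ y → bd (suc (suc k)) e y ≡ c y))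

  DiagonalGraph : Set
  DiagonalGraph = ∀ k l → k ≢ l → MHVanishes k l

-- Every sequence is either matched or unmatched with ℓ equal to its number of
-- steps: growing a sequence one vertex at a time, an unmatched prefix either gets
-- matched through F, or F = ε and then diagonality forces the new step to have
-- length 1, while a matched prefix stays matched by the prefix property.  So for
-- k ≠ l every generator of MC_{k,l} is matched, and the algebraic Morse argument
-- applies: modulo boundaries a cycle is cleared one generator at a time, always
-- choosing one that no other generator of its support reaches by a two-step path
-- of Γ^M.  A generator matched downwards then carries coefficient 0, and one
-- matched upwards is cancelled by subtracting a multiple of the boundary of its
-- partner.  Acyclicity of Γ^M is exactly what guarantees such a choice exists.
module Submission where

open import Defs
open import Data.Nat using (ℕ)
open import Relation.Nullary using (¬_; Dec)
open import Relation.Binary.PropositionalEquality using (_≢_)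
open import Relation.Binary.Definitions using (DecidableEquality)
open import Relation.Binary.Construct.Closure.Transitive using (TransClosure)

module ShortestPath (G : Graph) where

  open import Data.Nat using (zero; suc; _+_; _≤_; _<_; z≤n; s≤s)
  open import Data.Nat.Properties
  open import Data.Bool using (true; false; T)
  open import Data.Bool.Properties using (T-∧; T-∨)
  open import Data.Fin using (Fin)
  import Data.Fin as Fin
  open import Data.List using (allFin)
  open import Data.List.Relation.Unary.Any using (satisfied)
  import Data.List.Relation.Unary.Any as Any
  open import Data.List.Relation.Unary.Any.Properties using (any⁺; any⁻)
  open import Data.List.Membership.Propositional.Properties using (∈-allFin)
  open import Data.Product using (_×_; _,_; ∃-syntax)
  open import Data.Sum using (_⊎_; inj₁; inj₂)
  open import Data.Empty using (⊥; ⊥-elim)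
  open import Function.Bundles using (Equivalence)
  open import Relation.Nullary using (yes; no; contradiction)
  open import Relation.Binary.PropositionalEquality

  open Graph G
  open Equivalence using (to; from)

  reach-zero⁻ : ∀ x y → T (reach G 0 x y) → x ≡ y
  reach-zero⁻ x y r with x Fin.≟ y
  ... | yes x≡y = x≡y
  ... | no _ = ⊥-elim r

  reach-zero-refl : ∀ x → T (reach G 0 x x)
  reach-zero-refl x with x Fin.≟ x
  ... | yes _ = _
  ... | no x≢x = contradiction refl x≢x

  reach-suc : ∀ m x y → T (reach G m x y) → T (reach G (suc m) x y)
  reach-suc m x y r = from T-∨ (inj₁ r)

  reach-step : ∀ m x z y → T (reach G m x z) → T (adj z y) → T (reach G (suc m) x y)
  reach-step m x z y r e =
    from T-∨ (inj₂ (any⁺ _ (Any.map (λ { refl → from T-∧ (r , e) }) (∈-allFin z))))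

  reach-suc⁻ : ∀ m x y → T (reach G (suc m) x y) →
               T (reach G m x y) ⊎ ∃[ z ] (T (reach G m x z) × T (adj z y))
  reach-suc⁻ m x y r with to T-∨ r
  ... | inj₁ r′ = inj₁ r′
  ... | inj₂ r′ with satisfied (any⁻ _ (allFin n) r′)
  ...   | z , rz = inj₂ (z , to T-∧ rz)

  reach-trans : ∀ m m′ x y z → T (reach G m x y) → T (reach G m′ y z) → T (reach G (m + m′) x z)
  reach-trans m zero x y z r r′ rewrite +-identityʳ m | reach-zero⁻ y z r′ = r
  reach-trans m (suc m′) x y z r r′ rewrite +-suc m m′ with reach-suc⁻ m′ y z r′
  ... | inj₁ r″ = reach-suc (m + m′) x z (reach-trans m m′ x y z r r″)
  ... | inj₂ (w , r″ , e) = reach-step (m + m′) x w z (reach-trans m m′ x y w r r″) e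

  dsearch-≤ : ∀ x y f m → dsearch G x y f m ≤ f + m
  dsearch-≤ x y zero m = ≤-refl
  dsearch-≤ x y (suc f) m with reach G m x y
  ... | true = m≤n+m m (suc f)
  ... | false = ≤-trans (dsearch-≤ x y f (suc m)) (≤-reflexive (+-suc f m))

  dsearch-reaches : ∀ x y f m → T (reach G (dsearch G x y f m) x y) ⊎ dsearch G x y f m ≡ f + m
  dsearch-reaches x y zero m = inj₂ refl
  dsearch-reaches x y (suc f) m with reach G m x y in e
  ... | true = inj₁ (subst T (sym e) _)
  ... | false with dsearch-reaches x y f (suc m)
  ...   | inj₁ r = inj₁ r
  ...   | inj₂ h = inj₂ (trans h (+-suc f m))

  dsearch-least : ∀ x y f m m′ → m ≤ m′ → T (reach G m′ x y) → dsearch G x y f m ≤ m′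
  dsearch-least x y zero m m′ m≤m′ _ = m≤m′
  dsearch-least x y (suc f) m m′ m≤m′ r with reach G m x y in e
  ... | true = m≤m′
  ... | false with m ≟ m′
  ...   | yes refl = ⊥-elim (subst T e r)
  ...   | no m≢m′ = dsearch-least x y f (suc m) m′ (≤∧≢⇒< m≤m′ m≢m′) r

  d≤n : ∀ x y → d G x y ≤ n
  d≤n x y = ≤-trans (dsearch-≤ x y n 0) (≤-reflexive (+-identityʳ n))

  d<n⇒reach : ∀ x y → d G x y < n → T (reach G (d G x y) x y)
  d<n⇒reach x y d<n with dsearch-reaches x y n 0
  ... | inj₁ r = r
  ... | inj₂ d≡n = contradiction (trans d≡n (+-identityʳ n)) (<⇒≢ d<n)

  d-least : ∀ m x y → T (reach G m x y) → d G x y ≤ m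
  d-least m x y = dsearch-least x y n 0 m z≤n

  d-triangle : ∀ a b c → d G a c ≤ d G a b + d G b c
  d-triangle a b c with d G a b <? n | d G b c <? n
  ... | yes p | yes q =
    d-least _ a c (reach-trans (d G a b) (d G b c) a b c (d<n⇒reach a b p) (d<n⇒reach b c q))
  ... | no p | _ = ≤-trans (d≤n a c) (≤-trans (≮⇒≥ p) (m≤m+n _ _))
  ... | yes _ | no q = ≤-trans (d≤n a c) (≤-trans (≮⇒≥ q) (m≤n+m _ _))

  d-self : ∀ a → d G a a ≡ 0
  d-self a = n≤0⇒n≡0 (d-least 0 a a (reach-zero-refl a))

  ≢⇒0<d : ∀ a b → a ≢ b → 0 < d G a b
  ≢⇒0<d a b a≢b with d G a b in e
  ... | suc _ = s≤s z≤n
  ... | zero with dsearch-reaches a b n 0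
  ...   | inj₁ r = contradiction (reach-zero⁻ a b (subst (λ m → T (reach G m a b)) e r)) a≢b
  ...   | inj₂ d≡n = ⊥-elim (empty (trans (sym (+-identityʳ n)) (trans (sym d≡n) e)) a)
    where
    empty : n ≡ 0 → Fin n → ⊥
    empty refl ()

module Sequences (G : Graph) where

  open import Data.Nat using (ℕ; zero; suc; _+_; _≤_; _<_; z≤n; s≤s)
  open import Data.Nat.Properties
  open import Data.List using (List; []; _∷_; _++_; take; length)
  open import Data.Product using (_,_; ∃-syntax)
  open import Data.Unit using (tt)
  open import Relation.Binary.PropositionalEquality

  open ShortestPath G

  V : Set
  V = Vtx G

  take-++ˡ : ∀ k (q r : List V) → k ≤ length q → take k (q ++ r) ≡ take k q
  take-++ˡ zero q r _ = refl
  take-++ˡ (suc k) (a ∷ q) r (s≤s k≤q) = cong (a ∷_) (take-++ˡ k q r k≤q)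

  length-del : ∀ i (x : List V) → i < length x → suc (length (del G i x)) ≡ length x
  length-del zero (a ∷ x) _ = refl
  length-del (suc i) (a ∷ x) (s≤s i<x) = cong suc (length-del i x i<x)

  del-del : ∀ i j (x : List V) → i ≤ j → del G j (del G i x) ≡ del G i (del G (suc j) x)
  del-del zero zero [] _ = refl
  del-del zero (suc j) [] _ = refl
  del-del zero j (a ∷ x) _ = refl
  del-del (suc i) (suc j) [] _ = refl
  del-del (suc i) (suc j) (a ∷ x) (s≤s i≤j) = cong (a ∷_) (del-del i j x i≤j)

  ≡-ins-del : ∀ j (z : List V) → suc j < length z → ∃[ w ] z ≡ ins G j w (del G (suc j) z)
  ≡-ins-del zero (a ∷ b ∷ z) _ = b , refl
  ≡-ins-del zero (a ∷ []) (s≤s ())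
  ≡-ins-del (suc j) (a ∷ z) (s≤s j<z) with ≡-ins-del j z j<z
  ... | w , e = w , cong (a ∷_) e

  AdjDistinct-tail : ∀ a (x : List V) → AdjDistinct G (a ∷ x) → AdjDistinct G x
  AdjDistinct-tail a [] _ = tt
  AdjDistinct-tail a (b ∷ x) (_ , ad) = ad

  AdjDistinct-init : ∀ (q : List V) b → AdjDistinct G (q ++ b ∷ []) → AdjDistinct G q
  AdjDistinct-init [] b _ = tt
  AdjDistinct-init (a ∷ []) b _ = tt
  AdjDistinct-init (a ∷ c ∷ q) b (a≢c , ad) = a≢c , AdjDistinct-init (c ∷ q) b ad

  AdjDistinct-last : ∀ (p : List V) a b → AdjDistinct G (p ++ a ∷ b ∷ []) → a ≢ b
  AdjDistinct-last [] a b (a≢b , _) = a≢b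
  AdjDistinct-last (c ∷ p) a b ad = AdjDistinct-last p a b (AdjDistinct-tail c (p ++ a ∷ b ∷ []) ad)

  del≢del : ∀ i j (x : List V) → i < j → j < length x → AdjDistinct G x → del G i x ≢ del G j x
  del≢del zero (suc j) (a ∷ b ∷ x) _ _ (a≢b , _) e = a≢b (sym (cong (λ { [] → b ; (c ∷ _) → c }) e))
  del≢del zero (suc j) (a ∷ []) _ (s≤s ()) _ _
  del≢del (suc i) (suc j) (a ∷ x) (s≤s i<j) (s≤s j<x) ad e =
    del≢del i j x i<j j<x (AdjDistinct-tail a x ad) (cong (λ { [] → [] ; (_ ∷ r) → r }) e)

  ℓ-del-≤ : ∀ i (x : List V) → ℓ G (del G i x) ≤ ℓ G x
  ℓ-del-≤ zero [] = z≤n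
  ℓ-del-≤ zero (a ∷ []) = z≤n
  ℓ-del-≤ zero (a ∷ b ∷ x) = m≤n+m _ _
  ℓ-del-≤ (suc i) [] = z≤n
  ℓ-del-≤ (suc zero) (a ∷ []) = z≤n
  ℓ-del-≤ (suc zero) (a ∷ b ∷ []) = z≤n
  ℓ-del-≤ (suc zero) (a ∷ b ∷ c ∷ x) = begin
      d G a c + ℓ G (c ∷ x)             ≤⟨ +-monoˡ-≤ _ (d-triangle a b c) ⟩
      d G a b + d G b c + ℓ G (c ∷ x)   ≡⟨ +-assoc (d G a b) _ _ ⟩
      d G a b + (d G b c + ℓ G (c ∷ x)) ∎
    where open ≤-Reasoning
  ℓ-del-≤ (suc (suc i)) (a ∷ []) = z≤n
  ℓ-del-≤ (suc (suc i)) (a ∷ b ∷ x) = +-monoʳ-≤ (d G a b) (ℓ-del-≤ (suc i) (b ∷ x))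

  -- Deleting b from (a, b, a, ...) would lose 2 d(a,b) > 0, so a length-preserving
  -- deletion never creates equal neighbours.
  del-AdjDistinct : ∀ i (x : List V) → AdjDistinct G x → ℓ G (del G i x) ≡ ℓ G x →
                    AdjDistinct G (del G i x)
  del-AdjDistinct zero [] ad _ = tt
  del-AdjDistinct zero (a ∷ x) ad _ = AdjDistinct-tail a x ad
  del-AdjDistinct (suc i) [] ad _ = tt
  del-AdjDistinct (suc zero) (a ∷ []) ad _ = tt
  del-AdjDistinct (suc zero) (a ∷ b ∷ []) ad _ = tt
  del-AdjDistinct (suc zero) (a ∷ b ∷ c ∷ x) (a≢b , _ , ad) e = a≢c , ad
    where
    a≢c : a ≢ c
    a≢c refl = 1+n≰n (begin
        suc L                   ≤⟨ +-monoˡ-≤ L (≢⇒0<d a b a≢b) ⟩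
        d G a b + L             ≤⟨ +-monoʳ-≤ (d G a b) (m≤n+m L (d G b a)) ⟩
        d G a b + (d G b a + L) ≡⟨ sym e ⟩
        d G a a + L             ≡⟨ cong (_+ L) (d-self a) ⟩
        L                       ∎)
      where
      open ≤-Reasoning
      L : ℕ
      L = ℓ G (a ∷ x)
  del-AdjDistinct (suc (suc i)) (a ∷ []) ad _ = tt
  del-AdjDistinct (suc (suc i)) (a ∷ b ∷ x) (a≢b , ad) e =
    a≢b , del-AdjDistinct (suc i) (b ∷ x) ad (+-cancelˡ-≡ (d G a b) _ _ e)

  IsSeq-del : ∀ i (x : List V) → IsSeq G x → suc i < length x → ℓ G (del G i x) ≡ ℓ G x →
              IsSeq G (del G i x)
  IsSeq-del i x (_ , ad) i+1<x e = 0<length , del-AdjDistinct i x ad e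
    where
    0<length : 1 ≤ length (del G i x)
    0<length = ≤-pred (≤-trans (s≤s (s≤s z≤n)) (≤-trans i+1<x
                 (≤-reflexive (sym (length-del i x (<-trans (n<1+n i) i+1<x))))))

  ℓ-snoc : ∀ p a b → ℓ G (p ++ a ∷ b ∷ []) ≡ ℓ G (p ++ a ∷ []) + d G a b
  ℓ-snoc [] a b = +-comm (d G a b) 0
  ℓ-snoc (c ∷ []) a b = trans (cong (d G c a +_) (ℓ-snoc [] a b)) (sym (+-assoc (d G c a) 0 _))
  ℓ-snoc (c ∷ e ∷ p) a b = trans (cong (d G c e +_) (ℓ-snoc (e ∷ p) a b)) (sym (+-assoc (d G c e) _ _))

module Classification (G : Graph) (F : MatchingRule G) (M : EdgeSet G)
    (pm : IsPrefixMatching G M) (gen : GeneratedBy G F M) (dr : DiagonalRule G F M) where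

  open import Data.Nat using (suc; _+_; _≤_; _∸_; z≤n; s≤s)
  open import Data.Nat.Properties
  open import Data.List using (List; []; _∷_; _++_; take; length; _∷ʳ_)
  open import Data.List.Properties using (length-++; ++-assoc)
  open import Data.List.Reverse using (Reverse; reverseView; []; _∶_∶ʳ_)
  open import Data.Product using (_×_; _,_; ∃-syntax; proj₁; proj₂)
  open import Data.Sum using (_⊎_; inj₁; inj₂)
  open import Relation.Nullary using (yes; no; contradiction)
  open import Relation.Binary.PropositionalEquality
  open import Function.Bundles using (Equivalence)

  open ShortestPath G
  open Sequences G
  open Equivalence using (to; from)

  M⊆Γ : ∀ a b → M a b → ΓEdge G a b
  M⊆Γ = proj₁ (proj₁ pm)

  partner-unique : ∀ x y z → MatchedWith G M x y → MatchedWith G M x z → y ≡ z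
  partner-unique = proj₂ (proj₁ pm)

  ins-state-prefix-closed : ∀ x i v → IsSeq G x → StateIns G M x i v →
                            ∀ y → IsSeq G y → take (suc (suc i)) y ≡ take (suc (suc i)) x → StateIns G M y i v
  ins-state-prefix-closed = proj₁ (proj₂ pm)

  del-state-prefix-closed : ∀ x i → IsSeq G x → StateDel G M x i →
                            ∀ y → IsSeq G y → take (suc (suc i)) y ≡ take (suc (suc i)) x → StateDel G M y i
  del-state-prefix-closed = proj₂ (proj₂ pm)

  Critical : List V → Set
  Critical x = Unmatched G M x × ℓ G x ≡ length x ∸ 1

  Matched : List V → Set
  Matched x = ∃[ y ] MatchedWith G M x y

  HasState : List V → Set
  HasState x = (∃[ i ] ∃[ w ] StateIns G M x i w × suc (suc i) ≤ length x)
             ⊎ (∃[ i ] StateDel G M x i × suc (suc i) ≤ length x)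

  HasState⇒Matched : ∀ x → HasState x → Matched x
  HasState⇒Matched x (inj₁ (_ , _ , st , _)) = _ , st
  HasState⇒Matched x (inj₂ (_ , st , _)) = _ , st

  Matched⇒HasState : ∀ x → Matched x → HasState x
  Matched⇒HasState x (z , inj₁ m) with M⊆Γ x z m
  ... | _ , _ , i , _ , i+1<x , z≡ , _ = inj₂ (i , inj₁ (subst (M x) z≡ m) , i+1<x)
  Matched⇒HasState x (z , inj₂ m) with M⊆Γ z x m
  ... | _ , _ , suc j , _ , j+2<z , x≡ , _ with ≡-ins-del j z (<-trans (n<1+n _) j+2<z)
  ...   | w , z≡ = inj₁ (j , w , inj₂ (subst (λ t → M t x) (trans z≡ (cong (ins G j w) (sym x≡))) m) ,
                         ≤-pred (≤-trans j+2<z (≤-reflexive length-z)))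
    where
    length-z : length z ≡ suc (length x)
    length-z = trans (sym (length-del (suc j) z (<-trans (n<1+n _) j+2<z))) (cong (λ t → suc (length t)) (sym x≡))

  HasState-extend : ∀ q y → IsSeq G q → IsSeq G y → length q ≤ length y →
                    (∀ k → k ≤ length q → take k y ≡ take k q) → HasState q → HasState y
  HasState-extend q y sq sy q≤y agree (inj₁ (i , w , st , le)) =
    inj₁ (i , w , ins-state-prefix-closed q i w sq st y sy (agree (suc (suc i)) le) , ≤-trans le q≤y)
  HasState-extend q y sq sy q≤y agree (inj₂ (i , st , le)) =
    inj₂ (i , del-state-prefix-closed q i sq st y sy (agree (suc (suc i)) le) , ≤-trans le q≤y)

  singleton-unmatched : ∀ a → Unmatched G M (a ∷ [])
  singleton-unmatched a z mw with Matched⇒HasState (a ∷ []) (z , mw)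
  ... | inj₁ (_ , _ , _ , s≤s ())
  ... | inj₂ (_ , _ , s≤s ())

  module Extension (p : List V) (a b : V) (sx : IsSeq G (p ++ a ∷ b ∷ [])) where

    x q : List V
    x = p ++ a ∷ b ∷ []
    q = p ++ a ∷ []

    length-q : length q ≡ suc (length p)
    length-q = trans (length-++ p) (+-comm _ 1)

    length-x : length x ≡ suc (suc (length p))
    length-x = trans (length-++ p) (+-comm _ 2)

    take-x≡take-q : ∀ k → k ≤ length q → take k x ≡ take k q
    take-x≡take-q k k≤q = trans (cong (take k) (sym (++-assoc p (a ∷ []) (b ∷ [])))) (take-++ˡ k q (b ∷ []) k≤q)

    sq : IsSeq G q
    sq = subst (1 ≤_) (sym length-q) (s≤s z≤n) ,
         AdjDistinct-init q b (subst (AdjDistinct G) (sym (++-assoc p (a ∷ []) (b ∷ []))) (proj₂ sx))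

    q≤x : length q ≤ length x
    q≤x = subst₂ _≤_ (sym length-q) (sym length-x) (n≤1+n _)

    extend-matched : Matched q → Matched x
    extend-matched mq =
      HasState⇒Matched x (HasState-extend q x sq sx q≤x take-x≡take-q (Matched⇒HasState q mq))

    index-in-prefix : ∀ i → suc (suc i) ≤ length x → i ≢ length p → suc (suc i) ≤ length q
    index-in-prefix i le i≢p = subst (suc (suc i) ≤_) (sym length-q)
                       (s≤s (≤∧≢⇒< (≤-pred (≤-pred (subst (suc (suc i) ≤_) length-x le))) i≢p))

    -- A state of x at an index below length p would already be a state of q.
    ε-unmatched : Unmatched G M q → F x ≡ ε → Unmatched G M x
    ε-unmatched unq Fx≡ε z mw with Matched⇒HasState x (z , mw)
    ... | inj₁ (i , w , st , le) with i ≟ length p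
    ...   | yes refl with () ← trans (sym (to (proj₁ (gen p a b sx unq) w) st)) Fx≡ε
    ...   | no i≢p = unq _ (ins-state-prefix-closed x i w sx st q sq (sym (take-x≡take-q _ (index-in-prefix i le i≢p))))
    ε-unmatched unq Fx≡ε z mw | inj₂ (i , st , le) with i ≟ length p
    ...   | yes refl with () ← trans (sym (to (proj₂ (gen p a b sx unq)) st)) Fx≡ε
    ...   | no i≢p = unq _ (del-state-prefix-closed x i sx st q sq (sym (take-x≡take-q _ (index-in-prefix i le i≢p))))

    ε-adjacent : Unmatched G M q → F x ≡ ε → d G a b ≡ 1
    ε-adjacent unq Fx≡ε =
      ≤-antisym (≤-pred (≰⇒> (λ 2≤d → proj₂ dr p a b sx unq 2≤d Fx≡ε)))
                (≢⇒0<d a b (AdjDistinct-last p a b (proj₂ sx)))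

    critical-extend : Critical q → F x ≡ ε → Critical x
    critical-extend (unq , ℓq) Fx≡ε = ε-unmatched unq Fx≡ε , (begin
      ℓ G x                   ≡⟨ ℓ-snoc p a b ⟩
      ℓ G q + d G a b         ≡⟨ cong₂ _+_ ℓq (ε-adjacent unq Fx≡ε) ⟩
      (length q ∸ 1) + 1      ≡⟨ cong (λ t → (t ∸ 1) + 1) length-q ⟩
      length p + 1            ≡⟨ +-comm (length p) 1 ⟩
      suc (length p)          ≡⟨ cong (_∸ 1) (sym length-x) ⟩
      length x ∸ 1            ∎)
      where open ≡-Reasoning

    critical-or-matched-extend : Critical q ⊎ Matched q → Critical x ⊎ Matched x
    critical-or-matched-extend (inj₂ mq) = inj₂ (extend-matched mq)
    critical-or-matched-extend (inj₁ cq) with F x in Fx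
    ... | ι v = inj₂ (_ , from (proj₁ (gen p a b sx (proj₁ cq)) v) Fx)
    ... | δ = inj₂ (_ , from (proj₂ (gen p a b sx (proj₁ cq))) Fx)
    ... | ε = inj₁ (critical-extend cq Fx)

  critical-or-matched : ∀ x → IsSeq G x → Critical x ⊎ Matched x
  critical-or-matched x = go x (reverseView x)
    where
    go : ∀ x → Reverse x → IsSeq G x → Critical x ⊎ Matched x
    go .[] [] (() , _)
    go .([] ∷ʳ b) (.[] ∶ [] ∶ʳ b) _ = inj₁ (singleton-unmatched b , refl)
    go .((p ∷ʳ a) ∷ʳ b) (_ ∶ (p ∶ rp ∶ʳ a) ∶ʳ b) sx =
      subst (λ t → Critical t ⊎ Matched t) (sym assoc)
        (Extension.critical-or-matched-extend p a b sx′ (go (p ∷ʳ a) (p ∶ rp ∶ʳ a) (Extension.sq p a b sx′)))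
      where
      assoc : (p ∷ʳ a) ∷ʳ b ≡ p ++ a ∷ b ∷ []
      assoc = ++-assoc p (a ∷ []) (b ∷ [])
      sx′ : IsSeq G (p ++ a ∷ b ∷ [])
      sx′ = subst (IsSeq G) assoc sx

  off-diagonal-matched : ∀ k l x → k ≢ l → InMC G k l x → Matched x
  off-diagonal-matched k l x k≢l (sx , length-x , ℓx) with critical-or-matched x sx
  ... | inj₂ mx = mx
  ... | inj₁ (_ , ℓ≡) = contradiction (trans (sym (trans ℓ≡ (cong (_∸ 1) length-x))) ℓx) k≢l

module IntegerSums where

  open import Data.Nat using (ℕ; zero; suc; _≤_; z≤n; s≤s)
  import Data.Nat.Properties as ℕ
  open import Data.Integer using (ℤ; _+_; _*_; -_; 0ℤ)
  open import Data.Integer.Properties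
  open import Data.Integer.Tactic.RingSolver using (solve-∀)
  open import Data.Fin using (Fin)
  import Data.Fin as Fin
  import Data.Fin.Properties as Fin
  open import Data.List using (List; []; _∷_; _++_; map; concatMap; allFin; upTo; foldr; _∷ʳ_; tabulate)
  import Data.List.Properties as List
  open import Data.List.Membership.Propositional using (_∈_)
  open import Data.List.Relation.Unary.Any using (here; there)
  open import Data.Product using (_×_; _,_; Σ-syntax)
  open import Data.Empty using (⊥-elim)
  open import Relation.Nullary using (yes; no)
  open import Relation.Binary.PropositionalEquality
  open import Function using (_∘_; id)

  ∑ : List ℤ → ℤ
  ∑ = foldr _+_ 0ℤ

  module _ {A : Set} where

    ∑-++ : ∀ (xs ys : List ℤ) → ∑ (xs ++ ys) ≡ ∑ xs + ∑ ys
    ∑-++ [] ys = sym (+-identityˡ _)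
    ∑-++ (x ∷ xs) ys = trans (cong (x +_) (∑-++ xs ys)) (sym (+-assoc x _ _))

    ∑-map-+ : ∀ (f g : A → ℤ) L → ∑ (map (λ a → f a + g a) L) ≡ ∑ (map f L) + ∑ (map g L)
    ∑-map-+ f g [] = refl
    ∑-map-+ f g (a ∷ L) rewrite ∑-map-+ f g L = interchange (f a) (g a) (∑ (map f L)) (∑ (map g L))
      where
      interchange : ∀ p q r s → p + q + (r + s) ≡ p + r + (q + s)
      interchange = solve-∀

    ∑-map-*ˡ : ∀ c (f : A → ℤ) L → ∑ (map (λ a → c * f a) L) ≡ c * ∑ (map f L)
    ∑-map-*ˡ c f [] = sym (*-zeroʳ c)
    ∑-map-*ˡ c f (a ∷ L) rewrite ∑-map-*ˡ c f L = sym (*-distribˡ-+ c (f a) _)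

    ∑-map-*ʳ : ∀ c (f : A → ℤ) L → ∑ (map (λ a → f a * c) L) ≡ ∑ (map f L) * c
    ∑-map-*ʳ c f [] = refl
    ∑-map-*ʳ c f (a ∷ L) rewrite ∑-map-*ʳ c f L = sym (*-distribʳ-+ c (f a) _)

    ∑-map-zero : ∀ (f : A → ℤ) L → (∀ a → a ∈ L → f a ≡ 0ℤ) → ∑ (map f L) ≡ 0ℤ
    ∑-map-zero f [] _ = refl
    ∑-map-zero f (a ∷ L) f≡0 rewrite f≡0 a (here refl) | ∑-map-zero f L (λ b b∈L → f≡0 b (there b∈L)) = refl

    ∑-map-cong : ∀ (f g : A → ℤ) L → (∀ a → a ∈ L → f a ≡ g a) → ∑ (map f L) ≡ ∑ (map g L)
    ∑-map-cong f g [] _ = refl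
    ∑-map-cong f g (a ∷ L) f≡g rewrite f≡g a (here refl) | ∑-map-cong f g L (λ b b∈L → f≡g b (there b∈L)) = refl

  module _ {A B : Set} where

    ∑-concatMap : ∀ (f : B → ℤ) (g : A → List B) L →
                  ∑ (map f (concatMap g L)) ≡ ∑ (map (λ a → ∑ (map f (g a))) L)
    ∑-concatMap f g [] = refl
    ∑-concatMap f g (a ∷ L) = trans (cong ∑ (List.map-++ f (g a) (concatMap g L)))
      (trans (∑-++ {A} (map f (g a)) _) (cong (∑ (map f (g a)) +_) (∑-concatMap f g L)))

    ∑-map-map : ∀ (f : B → ℤ) (g : A → B) L → ∑ (map f (map g L)) ≡ ∑ (map (λ a → f (g a)) L)
    ∑-map-map f g L = cong ∑ (sym (List.map-∘ L))

    ∑-swap : ∀ (f : A → B → ℤ) L K →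
             ∑ (map (λ a → ∑ (map (f a) K)) L) ≡ ∑ (map (λ b → ∑ (map (λ a → f a b) L)) K)
    ∑-swap f [] K = sym (∑-map-zero {B} (λ _ → 0ℤ) K (λ _ _ → refl))
    ∑-swap f (a ∷ L) K = trans (cong (∑ (map (f a) K) +_) (∑-swap f L K))
       (sym (∑-map-+ {B} (f a) (λ b → ∑ (map (λ a → f a b) L)) K))

  ∑-allFin-single : ∀ n (h : Fin n → ℤ) v → (∀ u → u ≢ v → h u ≡ 0ℤ) → ∑ (map h (allFin n)) ≡ h v
  ∑-allFin-single n h v h≡0 = trans (cong ∑ (List.map-tabulate id h)) (go n h v h≡0)
    where
    go : ∀ n (h : Fin n → ℤ) v → (∀ u → u ≢ v → h u ≡ 0ℤ) → ∑ (tabulate h) ≡ h v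
    go (suc n) h Fin.zero h≡0 = begin
      h Fin.zero + ∑ (tabulate (h ∘ Fin.suc))
        ≡⟨ cong (h Fin.zero +_) (sym (cong ∑ (List.map-tabulate {n = n} id (h ∘ Fin.suc)))) ⟩
      h Fin.zero + ∑ (map (h ∘ Fin.suc) (allFin n))
        ≡⟨ cong (h Fin.zero +_) (∑-map-zero _ (allFin n) (λ u _ → h≡0 (Fin.suc u) (λ ()))) ⟩
      h Fin.zero + 0ℤ
        ≡⟨ +-identityʳ _ ⟩
      h Fin.zero ∎
      where open ≡-Reasoning
    go (suc n) h (Fin.suc v) h≡0 = begin
      h Fin.zero + ∑ (tabulate (h ∘ Fin.suc))
        ≡⟨ cong (_+ ∑ (tabulate (h ∘ Fin.suc))) (h≡0 Fin.zero (λ ())) ⟩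
      0ℤ + ∑ (tabulate (h ∘ Fin.suc))
        ≡⟨ +-identityˡ _ ⟩
      ∑ (tabulate (h ∘ Fin.suc))
        ≡⟨ go n (h ∘ Fin.suc) v (λ u u≢v → h≡0 (Fin.suc u) (u≢v ∘ Fin.suc-injective)) ⟩
      h (Fin.suc v) ∎
      where open ≡-Reasoning

  sumTo : (ℕ → ℤ) → ℕ → ℤ
  sumTo f zero = 0ℤ
  sumTo f (suc k) = sumTo f k + f (suc k)

  ∑-upTo : ∀ (f : ℕ → ℤ) k → ∑ (map f (map suc (upTo k))) ≡ sumTo f k
  ∑-upTo f zero = refl
  ∑-upTo f (suc k) = begin
      ∑ (map f (map suc (upTo (suc k))))          ≡⟨ cong (λ t → ∑ (map f (map suc t))) (sym (List.upTo-∷ʳ k)) ⟩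
      ∑ (map f (map suc (upTo k ∷ʳ k)))           ≡⟨ cong (λ t → ∑ (map f t)) (List.map-++ suc (upTo k) (k ∷ [])) ⟩
      ∑ (map f (map suc (upTo k) ++ suc k ∷ []))  ≡⟨ cong ∑ (List.map-++ f (map suc (upTo k)) (suc k ∷ [])) ⟩
      ∑ (map f (map suc (upTo k)) ++ f (suc k) ∷ []) ≡⟨ ∑-++ {ℕ} (map f (map suc (upTo k))) _ ⟩
      ∑ (map f (map suc (upTo k))) + (f (suc k) + 0ℤ) ≡⟨ cong₂ _+_ (∑-upTo f k) (+-identityʳ _) ⟩
      sumTo f (suc k) ∎
    where open ≡-Reasoning

  sumTo-zero : ∀ (f : ℕ → ℤ) k → (∀ i → 1 ≤ i → i ≤ k → f i ≡ 0ℤ) → sumTo f k ≡ 0ℤ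
  sumTo-zero f zero _ = refl
  sumTo-zero f (suc k) f≡0
    rewrite sumTo-zero f k (λ i 1≤i i≤k → f≡0 i 1≤i (ℕ.m≤n⇒m≤1+n i≤k))
          | f≡0 (suc k) (s≤s z≤n) ℕ.≤-refl = refl

  sumTo-cong : ∀ (f g : ℕ → ℤ) k → (∀ i → 1 ≤ i → i ≤ k → f i ≡ g i) → sumTo f k ≡ sumTo g k
  sumTo-cong f g zero _ = refl
  sumTo-cong f g (suc k) f≡g =
    cong₂ _+_ (sumTo-cong f g k (λ i 1≤i i≤k → f≡g i 1≤i (ℕ.m≤n⇒m≤1+n i≤k)))
              (f≡g (suc k) (s≤s z≤n) ℕ.≤-refl)

  sumTo-single : ∀ (f : ℕ → ℤ) k j → 1 ≤ j → j ≤ k → (∀ i → 1 ≤ i → i ≤ k → i ≢ j → f i ≡ 0ℤ) →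
                 sumTo f k ≡ f j
  sumTo-single f zero j 1≤j j≤0 _ = ⊥-elim (ℕ.<⇒≱ 1≤j j≤0)
  sumTo-single f (suc k) j 1≤j j≤k+1 f≡0 with j ℕ.≟ suc k
  ... | yes refl = trans (cong (_+ f (suc k)) (sumTo-zero f k below)) (+-identityˡ _)
    where
    below : ∀ i → 1 ≤ i → i ≤ k → f i ≡ 0ℤ
    below i 1≤i i≤k = f≡0 i 1≤i (ℕ.m≤n⇒m≤1+n i≤k) (λ { refl → ℕ.1+n≰n i≤k })
  ... | no j≢k+1 =
    trans (cong₂ _+_ (sumTo-single f k j 1≤j (ℕ.≤-pred (ℕ.≤∧≢⇒< j≤k+1 j≢k+1)) below) top) (+-identityʳ _)
    where
    below : ∀ i → 1 ≤ i → i ≤ k → i ≢ j → f i ≡ 0ℤ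
    below i 1≤i i≤k = f≡0 i 1≤i (ℕ.m≤n⇒m≤1+n i≤k)
    top : f (suc k) ≡ 0ℤ
    top = f≡0 (suc k) (s≤s z≤n) ℕ.≤-refl (λ e → j≢k+1 (sym e))

  sumTo-*ˡ : ∀ c (f : ℕ → ℤ) k → c * sumTo f k ≡ sumTo (λ j → c * f j) k
  sumTo-*ˡ c f zero = *-zeroʳ c
  sumTo-*ˡ c f (suc k) = trans (*-distribˡ-+ c (sumTo f k) _) (cong (_+ c * f (suc k)) (sumTo-*ˡ c f k))

  sumTo-+ : ∀ (f g : ℕ → ℤ) k → sumTo (λ i → f i + g i) k ≡ sumTo f k + sumTo g k
  sumTo-+ f g zero = refl
  sumTo-+ f g (suc k) rewrite sumTo-+ f g k = interchange (sumTo f k) (sumTo g k) (f (suc k)) (g (suc k))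
    where
    interchange : ∀ p q r s → p + q + (r + s) ≡ p + r + (q + s)
    interchange = solve-∀

  sumTo≢0 : ∀ (f : ℕ → ℤ) k → sumTo f k ≢ 0ℤ → Σ[ i ∈ ℕ ] (1 ≤ i × i ≤ k × f i ≢ 0ℤ)
  sumTo≢0 f zero sum≢0 = ⊥-elim (sum≢0 refl)
  sumTo≢0 f (suc k) sum≢0 with f (suc k) ≟ 0ℤ
  ... | no fk≢0 = suc k , s≤s z≤n , ℕ.≤-refl , fk≢0
  ... | yes fk≡0 with sumTo≢0 f k (λ e → sum≢0 (cong₂ _+_ e fk≡0))
  ...   | i , 1≤i , i≤k , fi≢0 = i , 1≤i , ℕ.m≤n⇒m≤1+n i≤k , fi≢0

  sumTo-antisym : (T : ℕ → ℕ → ℤ) → (∀ i j → 1 ≤ i → i ≤ j → T (suc j) i ≡ - T i j) →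
                  ∀ k → sumTo (λ i → sumTo (T i) k) (suc k) ≡ 0ℤ
  sumTo-antisym T anti zero = refl
  sumTo-antisym T anti (suc k) = begin
     sumTo (λ i → sumTo (T i) k + T i (suc k)) (suc (suc k))
       ≡⟨ sumTo-+ (λ i → sumTo (T i) k) (λ i → T i (suc k)) (suc (suc k)) ⟩
     (inner + last-row) + (last-column + corner)
       ≡⟨ cong (λ t → (t + last-row) + (last-column + corner)) (sumTo-antisym T anti k) ⟩
     (0ℤ + last-row) + (last-column + corner)
       ≡⟨ regroup last-row last-column corner ⟩
     last-column + sumTo (T (suc (suc k))) (suc k)
       ≡⟨ sym (sumTo-+ (λ i → T i (suc k)) (T (suc (suc k))) (suc k)) ⟩
     sumTo (λ i → T i (suc k) + T (suc (suc k)) i) (suc k)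
       ≡⟨ sumTo-zero _ (suc k) pairs-cancel ⟩
     0ℤ ∎
    where
    open ≡-Reasoning
    inner last-row last-column corner : ℤ
    inner = sumTo (λ i → sumTo (T i) k) (suc k)
    last-row = sumTo (T (suc (suc k))) k
    last-column = sumTo (λ i → T i (suc k)) (suc k)
    corner = T (suc (suc k)) (suc k)
    regroup : ∀ p q r → (0ℤ + p) + (q + r) ≡ q + (p + r)
    regroup = solve-∀
    pairs-cancel : ∀ i → 1 ≤ i → i ≤ suc k → T i (suc k) + T (suc (suc k)) i ≡ 0ℤ
    pairs-cancel i 1≤i i≤k+1 = trans (cong (T i (suc k) +_) (anti i (suc k) 1≤i i≤k+1)) (+-inverseʳ (T i (suc k)))

module Boundary (G : Graph) where

  open import Data.Nat using (ℕ; zero; suc; _≤_; _<_; _∸_; s≤s)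
  import Data.Nat as ℕ
  import Data.Nat.Properties as ℕ
  open import Data.Integer using (ℤ; _+_; _*_; -_; 0ℤ; 1ℤ)
  open import Data.Integer.Properties
  open import Data.Bool using (true; false; T; _∧_; if_then_else_)
  import Data.Fin as Fin
  open import Data.List using (List; []; _∷_; map; allFin; upTo; length)
  import Data.List.Properties as List
  open import Data.Product using (_×_; _,_; Σ-syntax)
  open import Data.Empty using (⊥-elim)
  open import Relation.Nullary using (yes; no; does)
  open import Relation.Binary.PropositionalEquality
  open import Relation.Binary.Definitions using (tri<; tri≈; tri>)
  open import Data.Integer.Tactic.RingSolver using (solve-∀)

  open Sequences G
  open IntegerSums

  ∑-tuples-single : ∀ m (f : List V → ℤ) x → length x ≡ m → (∀ t → t ≢ x → f t ≡ 0ℤ) →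
                    ∑ (map f (tuples G m)) ≡ f x
  ∑-tuples-single zero f [] refl _ = +-identityʳ _
  ∑-tuples-single (suc m) f (v ∷ x) refl f≡0 = begin
      ∑ (map f (tuples G (suc m)))
        ≡⟨ ∑-concatMap f (λ u → map (u ∷_) (tuples G m)) (allFin (Graph.n G)) ⟩
      ∑ (map (λ u → ∑ (map f (map (u ∷_) (tuples G m)))) (allFin (Graph.n G)))
        ≡⟨ ∑-map-cong _ _ (allFin (Graph.n G)) (λ u _ → ∑-map-map f (u ∷_) (tuples G m)) ⟩
      ∑ (map (λ u → ∑ (map (λ t → f (u ∷ t)) (tuples G m))) (allFin (Graph.n G)))
        ≡⟨ ∑-allFin-single (Graph.n G) _ v (λ u u≢v → ∑-map-zero _ (tuples G m)
             (λ t _ → f≡0 (u ∷ t) (λ e → u≢v (List.∷-injectiveˡ e)))) ⟩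
      ∑ (map (λ t → f (v ∷ t)) (tuples G m))
        ≡⟨ ∑-tuples-single m (λ t → f (v ∷ t)) x refl
             (λ t t≢x → f≡0 (v ∷ t) (λ e → t≢x (List.∷-injectiveʳ e))) ⟩
      f (v ∷ x) ∎
    where open ≡-Reasoning

  inner-index< : ∀ i L → 1 ≤ i → i ≤ L ∸ 2 → suc i < L
  inner-index< i (suc (suc L)) _ i≤L = s≤s (s≤s i≤L)
  inner-index< i (suc zero) 1≤i i≤0 = ⊥-elim (ℕ.<⇒≱ 1≤i i≤0)
  inner-index< i zero 1≤i i≤0 = ⊥-elim (ℕ.<⇒≱ 1≤i i≤0)

  -- `does (m ℕ.≟ n)` computes to `m ℕ.≡ᵇ n`, so that is what `with` has to abstract.
  ≡ᵇ-true⇒≡ : ∀ m n → (m ℕ.≡ᵇ n) ≡ true → m ≡ n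
  ≡ᵇ-true⇒≡ m n e = ℕ.≡ᵇ⇒≡ m n (subst T (sym e) _)

  ≡ᵇ-false⇒≢ : ∀ m n → (m ℕ.≡ᵇ n) ≡ false → m ≢ n
  ≡ᵇ-false⇒≢ m n e m≡n = subst T e (ℕ.≡⇒≡ᵇ m n m≡n)

  face-coeff : List V → List V → ℕ → ℤ
  face-coeff x y i = if does (List.≡-dec Fin._≟_ (del G i x) y) ∧ does (ℓ G (del G i x) ℕ.≟ ℓ G x)
                     then sign G i else 0ℤ

  coeff≡sumTo : ∀ x y → coeff G x y ≡ sumTo (face-coeff x y) (length x ∸ 2)
  coeff≡sumTo x y = ∑-upTo (face-coeff x y) (length x ∸ 2)

  face-coeff≢0 : ∀ x y i → face-coeff x y i ≢ 0ℤ → del G i x ≡ y × ℓ G (del G i x) ≡ ℓ G x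
  face-coeff≢0 x y i ≢0 with List.≡-dec Fin._≟_ (del G i x) y | ℓ G (del G i x) ℕ.≡ᵇ ℓ G x in ℓ≡
  ... | yes del≡y | true = del≡y , ≡ᵇ-true⇒≡ _ _ ℓ≡
  ... | yes _ | false = ⊥-elim (≢0 refl)
  ... | no _ | _ = ⊥-elim (≢0 refl)

  coeff≢0⇒face : ∀ x y → coeff G x y ≢ 0ℤ →
                 Σ[ i ∈ ℕ ] (1 ≤ i × suc i < length x × del G i x ≡ y × ℓ G (del G i x) ≡ ℓ G x)
  coeff≢0⇒face x y ≢0 with sumTo≢0 (face-coeff x y) (length x ∸ 2) (λ e → ≢0 (trans (coeff≡sumTo x y) e))
  ... | i , 1≤i , i≤ , fi≢0 = i , 1≤i , inner-index< i (length x) 1≤i i≤ , face-coeff≢0 x y i fi≢0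

  face-sign : List V → ℕ → ℤ
  face-sign x i = if does (ℓ G (del G i x) ℕ.≟ ℓ G x) then sign G i else 0ℤ

  face-coeff-del : ∀ x i → face-coeff x (del G i x) i ≡ face-sign x i
  face-coeff-del x i with List.≡-dec Fin._≟_ (del G i x) (del G i x)
  ... | yes _ = refl
  ... | no ≢ = ⊥-elim (≢ refl)

  coeff-face : ∀ x i → AdjDistinct G x → 1 ≤ i → suc i < length x → ℓ G (del G i x) ≡ ℓ G x →
               coeff G x (del G i x) ≡ sign G i
  coeff-face x i ad 1≤i i+1<x ℓ≡ = begin
      coeff G x (del G i x)                    ≡⟨ coeff≡sumTo x (del G i x) ⟩
      sumTo (face-coeff x (del G i x)) (length x ∸ 2)
        ≡⟨ sumTo-single (face-coeff x (del G i x)) (length x ∸ 2) i 1≤i i≤ other-faces ⟩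
      face-coeff x (del G i x) i               ≡⟨ face-coeff-del x i ⟩
      face-sign x i                            ≡⟨ preserved ⟩
      sign G i                                 ∎
    where
    open ≡-Reasoning
    i≤ : i ℕ.≤ length x ∸ 2
    i≤ = ℕ.≤-trans (ℕ.≤-reflexive (sym (ℕ.m+n∸n≡m i 2)))
                   (ℕ.∸-monoˡ-≤ 2 (ℕ.≤-trans (ℕ.≤-reflexive (ℕ.+-comm i 2)) i+1<x))
    preserved : face-sign x i ≡ sign G i
    preserved with ℓ G (del G i x) ℕ.≡ᵇ ℓ G x in e
    ... | true = refl
    ... | false = ⊥-elim (≡ᵇ-false⇒≢ _ _ e ℓ≡)
    other-faces : ∀ j → 1 ≤ j → j ≤ length x ∸ 2 → j ≢ i → face-coeff x (del G i x) j ≡ 0ℤ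
    other-faces j 1≤j j≤ j≢i with List.≡-dec Fin._≟_ (del G j x) (del G i x)
    ... | no _ = refl
    ... | yes del≡ with ℕ.<-cmp i j
    ...   | tri< i<j _ _ =
      ⊥-elim (del≢del i j x i<j (ℕ.<-trans (ℕ.n<1+n j) (inner-index< j (length x) 1≤j j≤)) ad (sym del≡))
    ...   | tri≈ _ i≡j _ = ⊥-elim (j≢i (sym i≡j))
    ...   | tri> _ _ j<i = ⊥-elim (del≢del j i x j<i (ℕ.<-trans (ℕ.n<1+n i) i+1<x) ad del≡)

  sign*sign≡1 : ∀ i → sign G i * sign G i ≡ 1ℤ
  sign*sign≡1 zero = refl
  sign*sign≡1 (suc i) = begin
    - sign G i * - sign G i   ≡⟨ sym (neg-distribˡ-* (sign G i) (- sign G i)) ⟩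
    - (sign G i * - sign G i) ≡⟨ cong -_ (sym (neg-distribʳ-* (sign G i) (sign G i))) ⟩
    - - (sign G i * sign G i) ≡⟨ neg-involutive _ ⟩
    sign G i * sign G i       ≡⟨ sign*sign≡1 i ⟩
    1ℤ                        ∎
    where open ≡-Reasoning

  double-face-coeff : List V → List V → ℕ → ℕ → ℤ
  double-face-coeff x y i j =
    if does (List.≡-dec Fin._≟_ (del G j (del G i x)) y) ∧ does (ℓ G (del G j (del G i x)) ℕ.≟ ℓ G x)
    then sign G i * sign G j else 0ℤ

  ≡ᵇ-chain : ∀ a b c → a ℕ.≤ b → b ℕ.≤ c → (a ℕ.≡ᵇ c) ≡ (a ℕ.≡ᵇ b) ∧ (b ℕ.≡ᵇ c)
  ≡ᵇ-chain a b c a≤b b≤c with a ℕ.≡ᵇ b in p | b ℕ.≡ᵇ c in q | a ℕ.≡ᵇ c in r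
  ... | true | true | true = refl
  ... | true | true | false = ⊥-elim (≡ᵇ-false⇒≢ a c r (trans (≡ᵇ-true⇒≡ a b p) (≡ᵇ-true⇒≡ b c q)))
  ... | true | false | true = ⊥-elim (≡ᵇ-false⇒≢ b c q (trans (sym (≡ᵇ-true⇒≡ a b p)) (≡ᵇ-true⇒≡ a c r)))
  ... | true | false | false = refl
  ... | false | true | true = ⊥-elim (≡ᵇ-false⇒≢ a b p (trans (≡ᵇ-true⇒≡ a c r) (sym (≡ᵇ-true⇒≡ b c q))))
  ... | false | true | false = refl
  ... | false | false | true = ⊥-elim (≡ᵇ-false⇒≢ a b p
          (ℕ.≤-antisym a≤b (ℕ.≤-trans b≤c (ℕ.≤-reflexive (sym (≡ᵇ-true⇒≡ a c r))))))
  ... | false | false | false = refl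

  -- Since deletions never increase ℓ, two deletions preserve ℓ iff each one does.
  face-sign*face-coeff : ∀ x y i j → face-sign x i * face-coeff (del G i x) y j ≡ double-face-coeff x y i j
  face-sign*face-coeff x y i j with does (List.≡-dec Fin._≟_ (del G j (del G i x)) y)
  ... | false = *-zeroʳ (face-sign x i)
  ... | true
    rewrite ≡ᵇ-chain (ℓ G (del G j (del G i x))) (ℓ G (del G i x)) (ℓ G x) (ℓ-del-≤ j (del G i x)) (ℓ-del-≤ i x)
    with ℓ G (del G j (del G i x)) ℕ.≡ᵇ ℓ G (del G i x) | ℓ G (del G i x) ℕ.≡ᵇ ℓ G x
  ...   | true | true = refl
  ...   | true | false = refl
  ...   | false | true = *-zeroʳ (sign G i)
  ...   | false | false = refl

  double-face-coeff-antisym : ∀ x y i j → 1 ≤ i → i ≤ j →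
                              double-face-coeff x y (suc j) i ≡ - double-face-coeff x y i j
  double-face-coeff-antisym x y i j _ i≤j rewrite sym (del-del i j x i≤j)
    with does (List.≡-dec Fin._≟_ (del G j (del G i x)) y) ∧ does (ℓ G (del G j (del G i x)) ℕ.≟ ℓ G x)
  ... | true = trans (sym (neg-distribˡ-* (sign G j) (sign G i))) (cong -_ (*-comm (sign G j) (sign G i)))
  ... | false = refl

  ∑-face-coeff : ∀ k x y i → length x ≡ suc (suc k) → 1 ≤ i → i ≤ length x ∸ 2 →
                 ∑ (map (λ z → face-coeff x z i * coeff G z y) (tuples G (suc k)))
                 ≡ sumTo (double-face-coeff x y i) (k ∸ 1)
  ∑-face-coeff k x y i length-x 1≤i i≤ = begin
      ∑ (map (λ z → face-coeff x z i * coeff G z y) (tuples G (suc k)))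
        ≡⟨ ∑-tuples-single (suc k) _ (del G i x) length-del-x other-faces ⟩
      face-coeff x (del G i x) i * coeff G (del G i x) y
        ≡⟨ cong₂ _*_ (face-coeff-del x i) (coeff≡sumTo (del G i x) y) ⟩
      face-sign x i * sumTo (face-coeff (del G i x) y) (length (del G i x) ∸ 2)
        ≡⟨ sumTo-*ˡ (face-sign x i) (face-coeff (del G i x) y) (length (del G i x) ∸ 2) ⟩
      sumTo (λ j → face-sign x i * face-coeff (del G i x) y j) (length (del G i x) ∸ 2)
        ≡⟨ cong (λ L → sumTo (λ j → face-sign x i * face-coeff (del G i x) y j) (L ∸ 2)) length-del-x ⟩
      sumTo (λ j → face-sign x i * face-coeff (del G i x) y j) (k ∸ 1)
        ≡⟨ sumTo-cong _ _ (k ∸ 1) (λ j _ _ → face-sign*face-coeff x y i j) ⟩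
      sumTo (double-face-coeff x y i) (k ∸ 1) ∎
    where
    open ≡-Reasoning
    length-del-x : length (del G i x) ≡ suc k
    length-del-x = ℕ.suc-injective
      (trans (length-del i x (ℕ.<-trans (ℕ.n<1+n i) (inner-index< i (length x) 1≤i i≤))) length-x)
    other-faces : ∀ z → z ≢ del G i x → face-coeff x z i * coeff G z y ≡ 0ℤ
    other-faces z z≢ with List.≡-dec Fin._≟_ (del G i x) z
    ... | yes del≡z = ⊥-elim (z≢ (sym del≡z))
    ... | no _ = refl

  ∂∂≡0 : ∀ k x y → length x ≡ suc (suc k) →
         ∑ (map (λ z → coeff G x z * coeff G z y) (tuples G (suc k))) ≡ 0ℤ
  ∂∂≡0 k x y length-x = begin
      ∑ (map (λ z → coeff G x z * coeff G z y) Z)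
        ≡⟨ ∑-map-cong _ _ Z (λ z _ → sym (∑-map-*ʳ (coeff G z y) (face-coeff x z) I)) ⟩
      ∑ (map (λ z → ∑ (map (λ i → face-coeff x z i * coeff G z y) I)) Z)
        ≡⟨ ∑-swap (λ z i → face-coeff x z i * coeff G z y) Z I ⟩
      ∑ (map (λ i → ∑ (map (λ z → face-coeff x z i * coeff G z y) Z)) I)
        ≡⟨ ∑-upTo _ (length x ∸ 2) ⟩
      sumTo (λ i → ∑ (map (λ z → face-coeff x z i * coeff G z y) Z)) (length x ∸ 2)
        ≡⟨ sumTo-cong _ _ (length x ∸ 2) (λ i → ∑-face-coeff k x y i length-x) ⟩
      sumTo (λ i → sumTo (double-face-coeff x y i) (k ∸ 1)) (length x ∸ 2)
        ≡⟨ cong (λ L → sumTo (λ i → sumTo (double-face-coeff x y i) (k ∸ 1)) (L ∸ 2)) length-x ⟩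
      sumTo (λ i → sumTo (double-face-coeff x y i) (k ∸ 1)) k
        ≡⟨ cancel k ⟩
      0ℤ ∎
    where
    open ≡-Reasoning
    Z : List (List V)
    Z = tuples G (suc k)
    I : List ℕ
    I = map suc (upTo (length x ∸ 2))
    cancel : ∀ k → sumTo (λ i → sumTo (double-face-coeff x y i) (k ∸ 1)) k ≡ 0ℤ
    cancel zero = refl
    cancel (suc k) = sumTo-antisym (double-face-coeff x y) (double-face-coeff-antisym x y) k

  bd-linear : ∀ m (f g : List V → ℤ) a t → bd G m (λ u → f u + a * g u) t ≡ bd G m f t + a * bd G m g t
  bd-linear m f g a t = begin
      ∑ (map (λ u → (f u + a * g u) * coeff G u t) Z)
        ≡⟨ ∑-map-cong _ _ Z (λ u _ → distrib (f u) (g u) a (coeff G u t)) ⟩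
      ∑ (map (λ u → f u * coeff G u t + a * (g u * coeff G u t)) Z)
        ≡⟨ ∑-map-+ (λ u → f u * coeff G u t) (λ u → a * (g u * coeff G u t)) Z ⟩
      bd G m f t + ∑ (map (λ u → a * (g u * coeff G u t)) Z)
        ≡⟨ cong (bd G m f t +_) (∑-map-*ˡ a (λ u → g u * coeff G u t) Z) ⟩
      bd G m f t + a * bd G m g t ∎
    where
    open ≡-Reasoning
    Z : List (List V)
    Z = tuples G m
    distrib : ∀ p q a c → (p + a * q) * c ≡ p * c + a * (q * c)
    distrib = solve-∀

  basis : List V → List V → ℤ
  basis x t = if does (List.≡-dec Fin._≟_ t x) then 1ℤ else 0ℤ

  basis-self : ∀ x → basis x x ≡ 1ℤ
  basis-self x with List.≡-dec Fin._≟_ x x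
  ... | yes _ = refl
  ... | no x≢x = ⊥-elim (x≢x refl)

  basis-other : ∀ x t → t ≢ x → basis x t ≡ 0ℤ
  basis-other x t t≢x with List.≡-dec Fin._≟_ t x
  ... | yes t≡x = ⊥-elim (t≢x t≡x)
  ... | no _ = refl

  bd-basis : ∀ m x t → length x ≡ m → bd G m (basis x) t ≡ coeff G x t
  bd-basis m x t length-x = begin
    bd G m (basis x) t        ≡⟨ ∑-tuples-single m _ x length-x (λ u u≢x → cong (_* coeff G u t) (basis-other x u u≢x)) ⟩
    basis x x * coeff G x t   ≡⟨ cong (_* coeff G x t) (basis-self x) ⟩
    1ℤ * coeff G x t          ≡⟨ *-identityˡ _ ⟩
    coeff G x t               ∎
    where open ≡-Reasoning

module MinimalElements {A : Set} (_≟_ : DecidableEquality A) (_≺_ : A → A → Set)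
    (_≺?_ : ∀ a b → Dec (a ≺ b)) (acyclic : ∀ a → ¬ TransClosure _≺_ a a) where

  open import Data.Nat using (zero; suc; _≤_; _<_)
  open import Data.Nat.Properties using (≤-pred; ≤-trans; ≤-refl)
  open import Data.List using (List; []; filter; length)
  open import Data.List.Properties using (filter-notAll)
  open import Data.List.Membership.Propositional using (_∈_; find; lose)
  open import Data.List.Membership.Propositional.Properties using (∈-filter⁺; ∈-filter⁻)
  import Data.List.Relation.Unary.Any as Any
  open import Data.List.Relation.Unary.Any using (any?)
  open import Data.Product using (_×_; _,_; ∃-syntax; proj₁)
  open import Relation.Nullary using (yes; no; ¬?)
  open import Relation.Binary.PropositionalEquality
  open import Relation.Binary.Construct.Closure.Transitive using ([_]; _∷ʳ_)

  _without_ : List A → A → List A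
  S without x = filter (λ v → ¬? (v ≟ x)) S

  length-without< : ∀ {x} S → x ∈ S → length (S without x) < length S
  length-without< S x∈S = filter-notAll (λ v → ¬? (v ≟ _)) S (Any.map (λ { refl x≢x → x≢x refl }) x∈S)

  ∈-without⁺ : ∀ {x w} S → w ∈ S → w ≢ x → w ∈ S without x
  ∈-without⁺ S = ∈-filter⁺ (λ v → ¬? (v ≟ _))

  ∈-without⁻ : ∀ {x w} S → w ∈ S without x → w ∈ S × w ≢ x
  ∈-without⁻ S = ∈-filter⁻ (λ v → ¬? (v ≟ _))

  IsMinimalIn : List A → A → Set
  IsMinimalIn S m = ∀ w → w ∈ S → ¬ (w ≺ m)

  minimal-below : ∀ n S → length S ≤ n → ∀ x → x ∈ S →
                  ∃[ m ] (m ∈ S × IsMinimalIn S m × (∀ w → w ≺ m → TransClosure _≺_ w x))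
  minimal-below zero [] _ x ()
  minimal-below (suc n) S |S|≤n+1 x x∈S with any? (_≺? x) S
  ... | no nothing≺x = x , x∈S , (λ w w∈S w≺x → nothing≺x (lose w∈S w≺x)) , (λ w w≺x → [ w≺x ])
  ... | yes something≺x with find something≺x
  ...   | w , w∈S , w≺x with minimal-below n (S without x) |S′|≤n w (∈-without⁺ S w∈S w≢x)
    where
    w≢x : w ≢ x
    w≢x refl = acyclic w [ w≺x ]
    |S′|≤n : length (S without x) ≤ n
    |S′|≤n = ≤-pred (≤-trans (length-without< S x∈S) |S|≤n+1)
  ...     | m , m∈S′ , m-minimal , m-below-w = m , proj₁ (∈-without⁻ S m∈S′) , m-minimal′ , m-below-x
    where
    m-below-x : ∀ w′ → w′ ≺ m → TransClosure _≺_ w′ x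
    m-below-x w′ w′≺m = m-below-w w′ w′≺m ∷ʳ w≺x
    m-minimal′ : IsMinimalIn S m
    m-minimal′ w′ w′∈S w′≺m with w′ ≟ x
    ... | yes refl = acyclic x (m-below-x x w′≺m)
    ... | no w′≢x = m-minimal w′ (∈-without⁺ S w′∈S w′≢x) w′≺m

  minimal : ∀ S x → x ∈ S → ∃[ m ] (m ∈ S × IsMinimalIn S m)
  minimal S x x∈S with minimal-below (length S) S ≤-refl x x∈S
  ... | m , m∈S , m-minimal , _ = m , m∈S , m-minimal

module MorseReduction (G : Graph) (F : MatchingRule G) (M : EdgeSet G)
    (pm : IsPrefixMatching G M) (gen : GeneratedBy G F M) (dr : DiagonalRule G F M)
    (morse : IsMorse G M) (k l : ℕ) (k≢l : k ≢ l) where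

  open import Data.Nat using (suc; _≤_)
  import Data.Nat as ℕ
  import Data.Nat.Properties as ℕ
  open import Data.Integer using (ℤ; _+_; _*_; -_; 0ℤ; 1ℤ; _≟_)
  open import Data.Integer.Properties using (*-zeroˡ; *-zeroʳ; +-identityˡ; +-identityʳ; *-identityʳ; *-assoc; +-inverseʳ)
  open import Data.Integer.Tactic.RingSolver using (solve-∀)
  import Data.Fin as Fin
  open import Data.List using (List; []; _∷_; map; length)
  import Data.List.Properties as List
  open import Data.List.Membership.Propositional using (_∈_)
  open import Data.List.Membership.Propositional.Properties using (∈-allFin; ∈-map⁺; ∈-concatMap⁺)
  open import Data.List.Relation.Unary.Any using (here)
  import Data.List.Relation.Unary.Any as Any
  open import Data.Product using (_×_; _,_; ∃-syntax; proj₁; proj₂)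
  open import Data.Sum using (_⊎_; inj₁; inj₂)
  open import Data.Unit using (tt)
  open import Data.Empty using (⊥; ⊥-elim)
  open import Relation.Nullary using (yes; no; ¬?)
  open import Relation.Nullary.Decidable using (_×-dec_; _⊎-dec_)
  open import Relation.Binary.PropositionalEquality
  open import Relation.Binary.Construct.Closure.Transitive using ([_]; _∷_) renaming (_++_ to _◅◅_)

  open Sequences G
  open Classification G F M pm gen dr
  open Boundary G
  open IntegerSums

  ≡-dec : DecidableEquality (List V)
  ≡-dec = List.≡-dec Fin._≟_

  AdjDistinct? : ∀ x → Dec (AdjDistinct G x)
  AdjDistinct? [] = yes tt
  AdjDistinct? (a ∷ []) = yes tt
  AdjDistinct? (a ∷ b ∷ x) = ¬? (a Fin.≟ b) ×-dec AdjDistinct? (b ∷ x)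

  InMC? : ∀ m x → Dec (InMC G m l x)
  InMC? m x = ((1 ℕ.≤? length x) ×-dec AdjDistinct? x) ×-dec (length x ℕ.≟ suc m) ×-dec (ℓ G x ℕ.≟ l)

  chain-support : ∀ m c → Chain G m l c → ∀ t → c t ≢ 0ℤ → InMC G m l t
  chain-support m c c-chain t ct≢0 with InMC? m t
  ... | yes t-cell = t-cell
  ... | no ¬t-cell = ⊥-elim (ct≢0 (c-chain t ¬t-cell))

  ∈-tuples : ∀ x → x ∈ tuples G (length x)
  ∈-tuples [] = here refl
  ∈-tuples (v ∷ x) = ∈-concatMap⁺ (λ w → map (w ∷_) (tuples G (length x)))
                       (Any.map (λ { refl → ∈-map⁺ (v ∷_) (∈-tuples x) }) (∈-allFin v))

  face-edge : ∀ x b → IsSeq G x → coeff G x b ≢ 0ℤ → ΓEdge G x b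
  face-edge x b sx coeff≢0 with coeff≢0⇒face x b coeff≢0
  ... | i , 1≤i , i+1<x , del≡b , ℓ≡ =
    sx , subst (IsSeq G) del≡b (IsSeq-del i x sx i+1<x ℓ≡) ,
    i , 1≤i , i+1<x , sym del≡b , trans (cong (ℓ G) (sym del≡b)) ℓ≡

  face-cell : ∀ m x b → InMC G (suc m) l x → coeff G x b ≢ 0ℤ → InMC G m l b
  face-cell m x b (sx , length-x , ℓx) coeff≢0 with face-edge x b sx coeff≢0
  ... | _ , sb , i , _ , i+1<x , b≡ , ℓ≡ =
    sb ,
    ℕ.suc-injective (trans (cong (λ t → suc (length t)) b≡)
                           (trans (length-del i x (ℕ.<-trans (ℕ.n<1+n i) i+1<x)) length-x)) ,
    trans ℓ≡ ℓx

  partner-cell : ∀ x x′ → InMC G k l x → M x′ x → InMC G (suc k) l x′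
  partner-cell x x′ (_ , length-x , ℓx) m with M⊆Γ x′ x m
  ... | sx′ , _ , i , _ , i+1<x′ , x≡ , ℓ≡ =
    sx′ , trans (sym (length-del i x′ (ℕ.<-trans (ℕ.n<1+n i) i+1<x′))) (cong suc (trans (cong length (sym x≡)) length-x)) ,
    trans (sym ℓ≡) ℓx

  matched-coeff² : ∀ a b → M a b → coeff G a b * coeff G a b ≡ 1ℤ
  matched-coeff² a b m with M⊆Γ a b m
  ... | (_ , ad) , _ , i , 1≤i , i+1<a , b≡ , ℓ≡ = begin
    coeff G a b * coeff G a b                   ≡⟨ cong (λ t → coeff G a t * coeff G a t) b≡ ⟩
    coeff G a (del G i a) * coeff G a (del G i a) ≡⟨ cong₂ _*_ κ κ ⟩
    sign G i * sign G i                         ≡⟨ sign*sign≡1 i ⟩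
    1ℤ                                          ∎
    where
    open ≡-Reasoning
    κ : coeff G a (del G i a) ≡ sign G i
    κ = coeff-face a i ad 1≤i i+1<a (trans (cong (ℓ G) (sym b≡)) ℓ≡)

  data Cell (x : List V) : Set where
    matched-up   : InMC G k l x → (x′ : List V) → M x′ x → Cell x
    matched-down : InMC G k l x → (y : List V) → M x y → Cell x
    outside      : ¬ InMC G k l x → Cell x

  cell : ∀ x → Cell x
  cell x with InMC? k x
  ... | no ¬x-cell = outside ¬x-cell
  ... | yes x-cell with off-diagonal-matched k l x k≢l x-cell
  ...   | y , inj₁ m = matched-down x-cell y m
  ...   | x′ , inj₂ m = matched-up x-cell x′ m

  UpLink : ∀ {a} → Cell a → List V → Set
  UpLink (matched-up _ x′ _) b = coeff G x′ b ≢ 0ℤ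
  UpLink _ _ = ⊥

  DownLink : ∀ {b} → List V → Cell b → Set
  DownLink a (matched-down _ y _) = coeff G a y ≢ 0ℤ
  DownLink _ _ = ⊥

  -- a ⇝ b packages the two-step paths a → partner → b of Γ^M inside degree k.
  _⇝_ : List V → List V → Set
  a ⇝ b = a ≢ b × IsSeq G a × (UpLink (cell a) b ⊎ DownLink a (cell b))

  UpLink? : ∀ {a} (ca : Cell a) b → Dec (UpLink ca b)
  UpLink? (matched-up _ x′ _) b = ¬? (coeff G x′ b ≟ 0ℤ)
  UpLink? (matched-down _ _ _) b = no (λ ())
  UpLink? (outside _) b = no (λ ())

  DownLink? : ∀ {b} a (cb : Cell b) → Dec (DownLink a cb)
  DownLink? a (matched-down _ y _) = ¬? (coeff G a y ≟ 0ℤ)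
  DownLink? a (matched-up _ _ _) = no (λ ())
  DownLink? a (outside _) = no (λ ())

  _⇝?_ : ∀ a b → Dec (a ⇝ b)
  a ⇝? b = ¬? (≡-dec a b) ×-dec ((1 ℕ.≤? length a) ×-dec AdjDistinct? a) ×-dec
           (UpLink? (cell a) b ⊎-dec DownLink? a (cell b))

  ⇝⇒path : ∀ {a b} → a ⇝ b → TransClosure (EdgeΓM G M) a b
  ⇝⇒path {a} {b} (a≢b , _ , inj₁ up) = go (cell a) up
    where
    go : (ca : Cell a) → UpLink ca b → TransClosure (EdgeΓM G M) a b
    go (matched-up _ x′ m) coeff≢0 =
      inj₂ m ∷ [ inj₁ (face-edge x′ b (proj₁ (M⊆Γ x′ a m)) coeff≢0 ,
                       (λ m′ → a≢b (partner-unique x′ a b (inj₁ m) (inj₁ m′)))) ]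
  ⇝⇒path {a} {b} (a≢b , sa , inj₂ down) = go (cell b) down
    where
    go : (cb : Cell b) → DownLink a cb → TransClosure (EdgeΓM G M) a b
    go (matched-down _ y m) coeff≢0 =
      inj₁ (face-edge a y sa coeff≢0 , (λ m′ → a≢b (partner-unique y a b (inj₂ m′) (inj₂ m)))) ∷ [ inj₂ m ]

  ⇝⁺⇒path : ∀ {a b} → TransClosure _⇝_ a b → TransClosure (EdgeΓM G M) a b
  ⇝⁺⇒path [ a⇝b ] = ⇝⇒path a⇝b
  ⇝⁺⇒path (a⇝b ∷ b⇝⁺c) = ⇝⇒path a⇝b ◅◅ ⇝⁺⇒path b⇝⁺c

  ⇝-acyclic : ∀ a → ¬ TransClosure _⇝_ a a
  ⇝-acyclic a cycle = morse a (⇝⁺⇒path cycle)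

  ⇝-cell : ∀ a b → a ⇝ b → InMC G k l b
  ⇝-cell a b (_ , _ , inj₁ up) = go (cell a) up
    where
    go : (ca : Cell a) → UpLink ca b → InMC G k l b
    go (matched-up a-cell x′ m) coeff≢0 = face-cell k x′ b (partner-cell a x′ a-cell m) coeff≢0
  ⇝-cell a b (_ , _ , inj₂ down) = go (cell b) down
    where
    go : (cb : Cell b) → DownLink a cb → InMC G k l b
    go (matched-down b-cell _ _) _ = b-cell

  IsBoundary : (List V → ℤ) → Set
  IsBoundary c₀ = ∃[ e ] (Chain G (suc k) l e × (∀ y → bd G (suc (suc k)) e y ≡ c₀ y))

  -- c₀ is written as c + ∂e, and the support of the cycle c is cleared one cell
  -- at a time, always taking a ⇝-minimal cell first.
  module Elimination (c₀ : List V → ℤ) where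

    open MinimalElements ≡-dec _⇝_ _⇝?_ ⇝-acyclic

    record Reduction : Set where
      field
        c e           : List V → ℤ
        c-chain       : Chain G k l c
        e-chain       : Chain G (suc k) l e
        c-cycle       : ∀ y → bd G (suc k) c y ≡ 0ℤ
        decomposition : ∀ t → c₀ t ≡ c t + bd G (suc (suc k)) e t

    open Reduction

    SupportedIn : Reduction → List (List V) → Set
    SupportedIn r S = ∀ t → c r t ≢ 0ℤ → t ∈ S

    Closed : List (List V) → Set
    Closed S = ∀ a → a ∈ S → ∀ b → a ⇝ b → b ∈ S

    reduction-[] : (r : Reduction) → SupportedIn r [] → IsBoundary c₀
    reduction-[] r support = e r , e-chain r , λ y → sym (begin
        c₀ y                              ≡⟨ decomposition r y ⟩
        c r y + bd G (suc (suc k)) (e r) y ≡⟨ cong (_+ bd G (suc (suc k)) (e r) y) (c≡0 y) ⟩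
        0ℤ + bd G (suc (suc k)) (e r) y    ≡⟨ +-identityˡ _ ⟩
        bd G (suc (suc k)) (e r) y         ∎)
      where
      open ≡-Reasoning
      c≡0 : ∀ y → c r y ≡ 0ℤ
      c≡0 y with c r y ≟ 0ℤ
      ... | yes cy≡0 = cy≡0
      ... | no cy≢0 with () ← support y cy≢0

    closed-without : ∀ S x → Closed S → IsMinimalIn S x → Closed (S without x)
    closed-without S x closed x-min a a∈S′ b a⇝b with ∈-without⁻ S a∈S′
    ... | a∈S , _ = ∈-without⁺ S (closed a a∈S b a⇝b) (λ { refl → x-min a a∈S a⇝b })

    drop-vanishing : ∀ S x r → SupportedIn r S → c r x ≡ 0ℤ → SupportedIn r (S without x)
    drop-vanishing S x r support cx≡0 t ct≢0 = ∈-without⁺ S (support t ct≢0) (λ { refl → ct≢0 cx≡0 })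

    down-matched-vanishes : ∀ S x r → SupportedIn r S → IsMinimalIn S x →
                            (x-cell : InMC G k l x) (y : List V) (m : M x y) →
                            cell x ≡ matched-down x-cell y m → c r x ≡ 0ℤ
    down-matched-vanishes S x r support x-min x-cell y m cell-x = begin
        c r x                                   ≡⟨ sym (*-identityʳ (c r x)) ⟩
        c r x * 1ℤ                              ≡⟨ cong (c r x *_) (sym (matched-coeff² x y m)) ⟩
        c r x * (coeff G x y * coeff G x y)     ≡⟨ sym (*-assoc (c r x) (coeff G x y) (coeff G x y)) ⟩
        c r x * coeff G x y * coeff G x y       ≡⟨ cong (_* coeff G x y) (sym ∂c-at-y) ⟩
        bd G (suc k) (c r) y * coeff G x y      ≡⟨ cong (_* coeff G x y) (c-cycle r y) ⟩
        0ℤ * coeff G x y                        ≡⟨ *-zeroˡ (coeff G x y) ⟩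
        0ℤ                                      ∎
      where
      open ≡-Reasoning
      -- Any other t contributing to ∂c at y would satisfy t ⇝ x.
      others : ∀ t → t ≢ x → c r t * coeff G t y ≡ 0ℤ
      others t t≢x with c r t ≟ 0ℤ | coeff G t y ≟ 0ℤ
      ... | yes ct≡0 | _ = cong (_* coeff G t y) ct≡0
      ... | no _ | yes coeff≡0 = trans (cong (c r t *_) coeff≡0) (*-zeroʳ (c r t))
      ... | no ct≢0 | no coeff≢0 = ⊥-elim (x-min t (support t ct≢0)
              (t≢x , proj₁ (chain-support k (c r) (c-chain r) t ct≢0) , inj₂ (subst (DownLink t) (sym cell-x) coeff≢0)))
      ∂c-at-y : bd G (suc k) (c r) y ≡ c r x * coeff G x y
      ∂c-at-y = ∑-tuples-single (suc k) _ x (proj₁ (proj₂ x-cell)) others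

    subtract-boundary : Reduction → ∀ x′ → InMC G (suc k) l x′ → ℤ → Reduction
    subtract-boundary r x′ x′-cell a = record
      { c = c′ ; e = e′ ; c-chain = c′-chain ; e-chain = e′-chain ; c-cycle = c′-cycle
      ; decomposition = decomposition′ }
      where
      c′ e′ : List V → ℤ
      c′ t = c r t + (- a) * coeff G x′ t
      e′ t = e r t + a * basis x′ t
      +0 : ∀ b → 0ℤ + b * 0ℤ ≡ 0ℤ
      +0 b = trans (+-identityˡ _) (*-zeroʳ b)
      c′-chain : Chain G k l c′
      c′-chain t ¬t-cell with coeff G x′ t ≟ 0ℤ
      ... | yes coeff≡0 = trans (cong₂ (λ p q → p + (- a) * q) (c-chain r t ¬t-cell) coeff≡0) (+0 (- a))
      ... | no coeff≢0 = ⊥-elim (¬t-cell (face-cell k x′ t x′-cell coeff≢0))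
      e′-chain : Chain G (suc k) l e′
      e′-chain t ¬t-cell with ≡-dec t x′
      ... | yes refl = ⊥-elim (¬t-cell x′-cell)
      ... | no _ = trans (cong (λ p → p + a * 0ℤ) (e-chain r t ¬t-cell)) (+0 a)
      c′-cycle : ∀ y → bd G (suc k) c′ y ≡ 0ℤ
      c′-cycle y = begin
        bd G (suc k) c′ y
          ≡⟨ bd-linear (suc k) (c r) (coeff G x′) (- a) y ⟩
        bd G (suc k) (c r) y + (- a) * bd G (suc k) (coeff G x′) y
          ≡⟨ cong₂ (λ p q → p + (- a) * q) (c-cycle r y) (∂∂≡0 k x′ y (proj₁ (proj₂ x′-cell))) ⟩
        0ℤ + (- a) * 0ℤ
          ≡⟨ +0 (- a) ⟩
        0ℤ ∎
        where open ≡-Reasoning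
      decomposition′ : ∀ t → c₀ t ≡ c′ t + bd G (suc (suc k)) e′ t
      decomposition′ t = begin
        c₀ t
          ≡⟨ decomposition r t ⟩
        c r t + ∂e
          ≡⟨ regroup (c r t) ∂e a (coeff G x′ t) ⟩
        c′ t + (∂e + a * coeff G x′ t)
          ≡⟨ cong (λ q → c′ t + (∂e + a * q)) (sym (bd-basis (suc (suc k)) x′ t (proj₁ (proj₂ x′-cell)))) ⟩
        c′ t + (∂e + a * bd G (suc (suc k)) (basis x′) t)
          ≡⟨ cong (c′ t +_) (sym (bd-linear (suc (suc k)) (e r) (basis x′) a t)) ⟩
        c′ t + bd G (suc (suc k)) e′ t ∎
        where
        open ≡-Reasoning
        ∂e : ℤ
        ∂e = bd G (suc (suc k)) (e r) t
        regroup : ∀ p q a u → p + q ≡ (p + (- a) * u) + (q + a * u)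
        regroup = solve-∀

    -- With a = c(x) ⟨∂x′, x⟩ the new coefficient at x is c(x) (1 - ⟨∂x′, x⟩²) = 0.
    cancel-up-matched : ∀ S x → x ∈ S → Closed S → ∀ r → SupportedIn r S →
                        (x-cell : InMC G k l x) (x′ : List V) (m : M x′ x) →
                        cell x ≡ matched-up x-cell x′ m → ∃[ r′ ] SupportedIn r′ (S without x)
    cancel-up-matched S x x∈S closed r support x-cell x′ m cell-x =
      subtract-boundary r x′ (partner-cell x x′ x-cell m) a , support′
      where
      κ a : ℤ
      κ = coeff G x′ x
      a = c r x * κ
      cx-cancels : c r x + (- a) * κ ≡ 0ℤ
      cx-cancels = begin
        c r x + (- (c r x * κ)) * κ ≡⟨ expand (c r x) κ ⟩
        c r x + - (c r x * (κ * κ)) ≡⟨ cong (λ q → c r x + - (c r x * q)) (matched-coeff² x′ x m) ⟩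
        c r x + - (c r x * 1ℤ)      ≡⟨ cong (λ q → c r x + - q) (*-identityʳ (c r x)) ⟩
        c r x + - c r x             ≡⟨ +-inverseʳ (c r x) ⟩
        0ℤ                          ∎
        where
        open ≡-Reasoning
        expand : ∀ p q → p + (- (p * q)) * q ≡ p + - (p * (q * q))
        expand = solve-∀
      support′ : ∀ t → c r t + (- a) * coeff G x′ t ≢ 0ℤ → t ∈ S without x
      support′ t c′t≢0 = ∈-without⁺ S t∈S (λ { refl → c′t≢0 cx-cancels })
        where
        t∈S : t ∈ S
        t∈S with c r t ≟ 0ℤ | coeff G x′ t ≟ 0ℤ
        ... | no ct≢0 | _ = support t ct≢0
        ... | yes ct≡0 | yes coeff≡0 = ⊥-elim (c′t≢0
              (trans (cong₂ (λ p q → p + (- a) * q) ct≡0 coeff≡0) (trans (+-identityˡ _) (*-zeroʳ (- a)))))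
        ... | yes _ | no coeff≢0 = closed x x∈S t
              ((λ { refl → c′t≢0 cx-cancels }) , proj₁ x-cell , inj₁ (subst (λ cx → UpLink cx t) (sym cell-x) coeff≢0))

    reduce-minimal : ∀ S x → x ∈ S → Closed S → IsMinimalIn S x → ∀ r → SupportedIn r S →
                     ∃[ r′ ] SupportedIn r′ (S without x)
    reduce-minimal S x x∈S closed x-min r support with c r x ≟ 0ℤ
    ... | yes cx≡0 = r , drop-vanishing S x r support cx≡0
    ... | no cx≢0 = by-cell (cell x) refl
      where
      by-cell : (cx : Cell x) → cell x ≡ cx → ∃[ r′ ] SupportedIn r′ (S without x)
      by-cell (outside ¬x-cell) _ = ⊥-elim (cx≢0 (c-chain r x ¬x-cell))
      by-cell (matched-down x-cell y m) cell-x =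
        ⊥-elim (cx≢0 (down-matched-vanishes S x r support x-min x-cell y m cell-x))
      by-cell (matched-up x-cell x′ m) cell-x = cancel-up-matched S x x∈S closed r support x-cell x′ m cell-x

    reduce : ∀ n S → length S ≤ n → Closed S → ∀ r → SupportedIn r S → IsBoundary c₀
    reduce _ [] _ _ r support = reduction-[] r support
    reduce (suc n) (s ∷ S) |S|≤n+1 closed r support with minimal (s ∷ S) s (here refl)
    ... | x , x∈S , x-min with reduce-minimal (s ∷ S) x x∈S closed x-min r support
    ...   | r′ , support′ =
      reduce n ((s ∷ S) without x) (ℕ.≤-pred (ℕ.≤-trans (length-without< (s ∷ S) x∈S) |S|≤n+1))
             (closed-without (s ∷ S) x closed x-min) r′ support′

    cycle-is-boundary : Chain G k l c₀ → (∀ y → bd G (suc k) c₀ y ≡ 0ℤ) → IsBoundary c₀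
    cycle-is-boundary c₀-chain c₀-cycle = reduce (length cells) cells ℕ.≤-refl closed initial initial-support
      where
      cells : List (List V)
      cells = tuples G (suc k)
      ∈-cells : ∀ t → InMC G k l t → t ∈ cells
      ∈-cells t (_ , length-t , _) = subst (λ m → t ∈ tuples G m) length-t (∈-tuples t)
      closed : Closed cells
      closed a _ b a⇝b = ∈-cells b (⇝-cell a b a⇝b)
      initial : Reduction
      initial = record
        { c = c₀ ; e = λ _ → 0ℤ ; c-chain = c₀-chain ; e-chain = λ _ _ → refl ; c-cycle = c₀-cycle
        ; decomposition = λ t → sym (trans (cong (c₀ t +_) (∑-map-zero _ (tuples G (suc (suc k))) (λ _ _ → refl)))
                                           (+-identityʳ _)) }
      initial-support : SupportedIn initial cells
      initial-support t c₀t≢0 = ∈-cells t (chain-support k c₀ c₀-chain t c₀t≢0)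

  off-diagonal-vanishing : MHVanishes G k l
  off-diagonal-vanishing c c-chain c-cycle = Elimination.cycle-is-boundary c c-chain c-cycle

corollary3p10 : (G : Graph) → Connected G → (F : MatchingRule G) → (M : EdgeSet G) →
                  IsPrefixMatching G M → GeneratedBy G F M → DiagonalRule G F M →
                  IsMorse G M → DiagonalGraph G
corollary3p10 G _ F M pm gen dr morse k l k≢l =
  MorseReduction.off-diagonal-vanishing G F M pm gen dr morse k l k≢l
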